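{- Let $k>0$ be real and $Q_{k,n}=F_{k,n}+i\,F_{k,n+1}+j\,F_{k,n+2}+ij\,F_{k,n+3}$. For every integer $n\ge1$: (1) $\sum_{s=1}^{n}Q_{k,s}=\frac1k\big(Q_{k,n+1}+Q_{k,n}-Q_{k,1}-Q_{k,0}\big)$; (2) $\sum_{s=1}^{n}Q_{k,2s-1}=\frac1k\big(Q_{k,2n}-Q_{k,0}\big)$; (3) $\sum_{s=1}^{n}Q_{k,2s}=\frac1k\big(Q_{k,2n+1}-Q_{k,1}\big)$.
   Context: For a real number $k>0$, the $k$-Fibonacci numbers are $F_{k,0}=0$, $F_{k,1}=1$, $F_{k,n+1}=kF_{k,n}+F_{k,n-1}$. Bicomplex numbers form the real commutative associative algebra with basis $\{1,i,j,ij\}$, $i^2=j^2=-1$, $ij=ji$, $(ij)^2=1$; $Q_{k,n}$ is the bicomplex $k$-Fibonacci quaternion. -}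

module Defs where

open import Level using (_⊔_)
open import Data.Nat using (ℕ; zero; suc)
open import Data.Product using (_×_)
open import Algebra.Bundles using (CommutativeRing)

-- Everything is developed over an arbitrary commutative ring R of scalars
-- (the paper uses R = ℝ, which is not available in agda-stdlib).
module Bicomplex {c ℓ} (R : CommutativeRing c ℓ) where
  open CommutativeRing R

  record 𝔹 : Set c where
    constructor bc
    field
      re  : Carrier
      ci  : Carrier
      cj  : Carrier
      cij : Carrier
  open 𝔹 public

  _≋_ : 𝔹 → 𝔹 → Set ℓ
  p ≋ q = (re p ≈ re q) × (ci p ≈ ci q) × (cj p ≈ cj q) × (cij p ≈ cij q)
  infix 4 _≋_

  _⊕_ : 𝔹 → 𝔹 → 𝔹
  bc a b c' d ⊕ bc a' b' c'' d' = bc (a + a') (b + b') (c' + c'') (d + d')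
  infixl 6 _⊕_

  ⊖_ : 𝔹 → 𝔹
  ⊖ bc a b c' d = bc (- a) (- b) (- c') (- d)

  _⊖_ : 𝔹 → 𝔹 → 𝔹
  p ⊖ q = p ⊕ (⊖ q)
  infixl 6 _⊖_

  -- multiplication with i² = j² = -1, ij = ji, (ij)² = 1
  _⊗_ : 𝔹 → 𝔹 → 𝔹
  bc a1 b1 c1 d1 ⊗ bc a2 b2 c2 d2 =
    bc (a1 * a2 - b1 * b2 - c1 * c2 + d1 * d2)
       (a1 * b2 + b1 * a2 - c1 * d2 - d1 * c2)
       (a1 * c2 + c1 * a2 - b1 * d2 - d1 * b2)
       (a1 * d2 + d1 * a2 + b1 * c2 + c1 * b2)
  infixl 7 _⊗_

  ι : Carrier → 𝔹
  ι a = bc a 0# 0# 0#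

  𝟏 𝐢 𝐣 𝐢𝐣 : 𝔹
  𝟏  = bc 1# 0# 0# 0#
  𝐢  = bc 0# 1# 0# 0#
  𝐣  = bc 0# 0# 1# 0#
  𝐢𝐣 = bc 0# 0# 0# 1#

  𝟎 : 𝔹
  𝟎 = ι 0#

  F : Carrier → ℕ → Carrier
  F k zero = 0#
  F k (suc zero) = 1#
  F k (suc (suc n)) = k * F k (suc n) + F k n

  Q : Carrier → ℕ → 𝔹
  Q k n = ι (F k n) ⊗ 𝟏 ⊕ ι (F k (suc n)) ⊗ 𝐢
        ⊕ ι (F k (suc (suc n))) ⊗ 𝐣 ⊕ ι (F k (suc (suc (suc n)))) ⊗ 𝐢𝐣

  Σ₁ : ℕ → (ℕ → 𝔹) → 𝔹
  Σ₁ zero f = 𝟎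
  Σ₁ (suc n) f = Σ₁ n f ⊕ f (suc n)

{-# OPTIONS --safe #-}
-- Every coordinate G of Q_{k,·} is a combination of shifts of F_k, hence satisfies
-- G (m+2) = k G (m+1) + G m.  Read as k G (m+1) = G (m+2) - G m, this makes each of the
-- three sums k·Σ telescope, to (G (n+1) + G n) - (G 1 + G 0), G (2n) - G 0 and
-- G (2n+1) - G 1 respectively; dividing by k gives the identities coordinatewise.
module Submission where

open import Defs
open import Level using (_⊔_)
open import Function using (_∘_)
open import Data.Nat using (ℕ; zero; suc; _≤_)
import Data.Nat as N
import Data.Nat.Properties as NP
open import Data.Product using (_×_; _,_)
open import Algebra.Bundles using (CommutativeSemiring; CommutativeRing)
import Algebra.Properties.CommutativeSemigroup as CommutativeSemigroupProperties
import Algebra.Properties.AbelianGroup as AbelianGroupProperties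
import Algebra.Properties.Ring as RingProperties
import Relation.Binary.PropositionalEquality as P
import Relation.Binary.Reasoning.Setoid as SetoidReasoning

module RecurrenceSums {c ℓ} (S : CommutativeSemiring c ℓ) where
  open CommutativeSemiring S
  open CommutativeSemigroupProperties +-commutativeSemigroup
    using (interchange; xy∙z≈xz∙y; xy∙z≈zy∙x)
  open SetoidReasoning setoid

  Recurrent : Carrier → (ℕ → Carrier) → Set ℓ
  Recurrent k G = ∀ m → G (suc (suc m)) ≈ k * G (suc m) + G m

  module _ {k : Carrier} where

    recurrent-cong : ∀ {G H} → (∀ m → G m ≈ H m) → Recurrent k G → Recurrent k H
    recurrent-cong {G} {H} G≈H rec m = begin
      H (suc (suc m))      ≈⟨ sym (G≈H _) ⟩
      G (suc (suc m))      ≈⟨ rec m ⟩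
      k * G (suc m) + G m  ≈⟨ +-cong (*-congˡ (G≈H _)) (G≈H m) ⟩
      k * H (suc m) + H m  ∎

    shift-recurrent : ∀ {G} → Recurrent k G → Recurrent k (G ∘ suc)
    shift-recurrent rec m = rec (suc m)

    +-recurrent : ∀ {G H} → Recurrent k G → Recurrent k H → Recurrent k (λ m → G m + H m)
    +-recurrent {G} {H} recG recH m = begin
      G (suc (suc m)) + H (suc (suc m))              ≈⟨ +-cong (recG m) (recH m) ⟩
      (k * G (suc m) + G m) + (k * H (suc m) + H m)  ≈⟨ interchange _ _ _ _ ⟩
      (k * G (suc m) + k * H (suc m)) + (G m + H m)  ≈⟨ +-congʳ (sym (distribˡ k _ _)) ⟩
      k * (G (suc m) + H (suc m)) + (G m + H m)      ∎

    *ʳ-recurrent : ∀ {G} → Recurrent k G → ∀ e → Recurrent k (λ m → G m * e)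
    *ʳ-recurrent {G} rec e m = begin
      G (suc (suc m)) * e            ≈⟨ *-congʳ (rec m) ⟩
      (k * G (suc m) + G m) * e      ≈⟨ distribʳ e _ _ ⟩
      k * G (suc m) * e + G m * e    ≈⟨ +-congʳ (*-assoc k _ e) ⟩
      k * (G (suc m) * e) + G m * e  ∎

  sum₁ : ℕ → (ℕ → Carrier) → Carrier
  sum₁ zero    f = 0#
  sum₁ (suc n) f = sum₁ n f + f (suc n)

  *-distribˡ-sum₁ : ∀ a f n → a * sum₁ n f ≈ sum₁ n (λ s → a * f s)
  *-distribˡ-sum₁ a f zero    = zeroʳ a
  *-distribˡ-sum₁ a f (suc n) =
    trans (distribˡ a (sum₁ n f) (f (suc n))) (+-congʳ (*-distribˡ-sum₁ a f n))

  -- Telescoping, stated without subtraction so that it holds in any semiring.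
  sum₁-telescope : ∀ f (T : ℕ → Carrier) → (∀ s → T s + f (suc s) ≈ T (suc s)) →
                   ∀ n → sum₁ n f + T 0 ≈ T n
  sum₁-telescope f T step zero    = +-identityˡ (T 0)
  sum₁-telescope f T step (suc n) = begin
    (sum₁ n f + f (suc n)) + T 0  ≈⟨ xy∙z≈xz∙y (sum₁ n f) _ _ ⟩
    (sum₁ n f + T 0) + f (suc n)  ≈⟨ +-congʳ (sum₁-telescope f T step n) ⟩
    T n + f (suc n)               ≈⟨ step n ⟩
    T (suc n)                     ∎

  module _ {k : Carrier} {G : ℕ → Carrier} (rec : Recurrent k G) where

    +-*-step : ∀ {m i j} → i P.≡ suc m → j P.≡ suc (suc m) → G m + k * G i ≈ G j
    +-*-step {m} P.refl P.refl = trans (+-comm _ _) (sym (rec m))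

    *-sum₁ : ∀ n → k * sum₁ n G + (G 1 + G 0) ≈ G (suc n) + G n
    *-sum₁ n = begin
      k * sum₁ n G + (G 1 + G 0)            ≈⟨ +-congʳ (*-distribˡ-sum₁ k G n) ⟩
      sum₁ n (λ s → k * G s) + (G 1 + G 0)  ≈⟨ sum₁-telescope _ (λ s → G (suc s) + G s) step n ⟩
      G (suc n) + G n                       ∎
      where
      step : ∀ s → (G (suc s) + G s) + k * G (suc s) ≈ G (suc (suc s)) + G (suc s)
      step s = trans (xy∙z≈zy∙x (G (suc s)) _ _) (+-congʳ (sym (rec s)))

    *-sum₁-odd : ∀ n → k * sum₁ n (λ s → G (2 N.* s N.∸ 1)) + G 0 ≈ G (2 N.* n)
    *-sum₁-odd n =
      trans (+-congʳ (*-distribˡ-sum₁ k _ n)) (sum₁-telescope _ (λ s → G (2 N.* s)) step n)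
      where
      step : ∀ s → G (2 N.* s) + k * G (2 N.* suc s N.∸ 1) ≈ G (2 N.* suc s)
      step s = +-*-step (P.cong (N._∸ 1) (NP.*-suc 2 s)) (NP.*-suc 2 s)

    *-sum₁-even : ∀ n → k * sum₁ n (λ s → G (2 N.* s)) + G 1 ≈ G (2 N.* n N.+ 1)
    *-sum₁-even n = begin
      k * sum₁ n (λ s → G (2 N.* s)) + G 1  ≈⟨ +-congʳ (*-distribˡ-sum₁ k _ n) ⟩
      sum₁ n (λ s → k * G (2 N.* s)) + G 1  ≈⟨ sum₁-telescope _ (λ s → G (suc (2 N.* s))) step n ⟩
      G (suc (2 N.* n))                     ≈⟨ reflexive (P.cong G (NP.+-comm 1 (2 N.* n))) ⟩
      G (2 N.* n N.+ 1)                     ∎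
      where
      step : ∀ s → G (suc (2 N.* s)) + k * G (2 N.* suc s) ≈ G (suc (2 N.* suc s))
      step s = +-*-step (NP.*-suc 2 s) (P.cong suc (NP.*-suc 2 s))

module BicomplexFibonacciSums {c ℓ} (R : CommutativeRing c ℓ) where
  open CommutativeRing R
  open Bicomplex R
  open RecurrenceSums commutativeSemiring
  open AbelianGroupProperties +-abelianGroup using (//-rightDividesʳ; ⁻¹-∙-comm)
  open RingProperties ring using (-‿distribʳ-*)
  open SetoidReasoning setoid

  F-recurrent : ∀ k → Recurrent k (F k)
  F-recurrent k m = refl

  record IsLinearFunctional (π : 𝔹 → Carrier) : Set (c ⊔ ℓ) where
    field
      ⊕-homo  : ∀ p q → π (p ⊕ q) ≈ π p + π q
      ⊖‿homo  : ∀ p → π (⊖ p) ≈ - π p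
      𝟎-homo  : π 𝟎 ≈ 0#
      ι⊗-homo : ∀ u p → π (ι u ⊗ p) ≈ u * π p

    ⊖-homo : ∀ p q → π (p ⊖ q) ≈ π p - π q
    ⊖-homo p q = trans (⊕-homo p (⊖ q)) (+-congˡ (⊖‿homo q))

    ι⊗⊖-homo : ∀ u p q → π (ι u ⊗ (p ⊖ q)) ≈ u * (π p - π q)
    ι⊗⊖-homo u p q = trans (ι⊗-homo u (p ⊖ q)) (*-congˡ (⊖-homo p q))

    Σ₁-homo : ∀ g n → π (Σ₁ n g) ≈ sum₁ n (π ∘ g)
    Σ₁-homo g zero    = 𝟎-homo
    Σ₁-homo g (suc n) = trans (⊕-homo _ _) (+-congʳ (Σ₁-homo g n))

    Q-homo : ∀ k m → π (Q k m) ≈ ((F k m * π 𝟏 + F k (suc m) * π 𝐢)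
                                  + F k (suc (suc m)) * π 𝐣) + F k (suc (suc (suc m))) * π 𝐢𝐣
    Q-homo k m =
      trans (⊕-homo _ _) (+-cong (trans (⊕-homo _ _) (+-cong (trans (⊕-homo _ _)
        (+-cong (ι⊗-homo _ _) (ι⊗-homo _ _))) (ι⊗-homo _ _))) (ι⊗-homo _ _))

    Q-recurrent : ∀ k → Recurrent k (π ∘ Q k)
    Q-recurrent k = recurrent-cong (λ m → sym (Q-homo k m))
      (+-recurrent (+-recurrent (+-recurrent
        (*ʳ-recurrent F₀ (π 𝟏)) (*ʳ-recurrent F₁ (π 𝐢))) (*ʳ-recurrent F₂ (π 𝐣)))
        (*ʳ-recurrent F₃ (π 𝐢𝐣)))
      where
      F₀ = F-recurrent k
      F₁ = shift-recurrent F₀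
      F₂ = shift-recurrent F₁
      F₃ = shift-recurrent F₂

  private
    +-vanishʳ : ∀ {x y} → y ≈ 0# → x + y ≈ x
    +-vanishʳ {x} y≈0 = trans (+-congˡ y≈0) (+-identityʳ x)

    -0*≈0 : ∀ x → - (0# * x) ≈ 0#
    -0*≈0 x = trans (-‿distribʳ-* 0# x) (zeroˡ (- x))

  -- In each coordinate of ι u ⊗ p all summands but one carry a factor 0#.
  re-linear : IsLinearFunctional re
  re-linear = record
    { ⊕-homo = λ _ _ → refl ; ⊖‿homo = λ _ → refl ; 𝟎-homo = refl
    ; ι⊗-homo = λ _ _ →
        trans (+-vanishʳ (zeroˡ _))
          (trans (+-vanishʳ (-0*≈0 _)) (+-vanishʳ (-0*≈0 _)))
    }

  ci-linear : IsLinearFunctional ci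
  ci-linear = record
    { ⊕-homo = λ _ _ → refl ; ⊖‿homo = λ _ → refl ; 𝟎-homo = refl
    ; ι⊗-homo = λ _ _ →
        trans (+-vanishʳ (-0*≈0 _))
          (trans (+-vanishʳ (-0*≈0 _)) (+-vanishʳ (zeroˡ _)))
    }

  cj-linear : IsLinearFunctional cj
  cj-linear = record
    { ⊕-homo = λ _ _ → refl ; ⊖‿homo = λ _ → refl ; 𝟎-homo = refl
    ; ι⊗-homo = λ _ _ →
        trans (+-vanishʳ (-0*≈0 _))
          (trans (+-vanishʳ (-0*≈0 _)) (+-vanishʳ (zeroˡ _)))
    }

  cij-linear : IsLinearFunctional cij
  cij-linear = record
    { ⊕-homo = λ _ _ → refl ; ⊖‿homo = λ _ → refl ; 𝟎-homo = refl
    ; ι⊗-homo = λ _ _ →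
        trans (+-vanishʳ (zeroˡ _))
          (trans (+-vanishʳ (zeroˡ _)) (+-vanishʳ (zeroˡ _)))
    }

  ≋-coordinatewise : ∀ {p q} → (∀ {π} → IsLinearFunctional π → π p ≈ π q) → p ≋ q
  ≋-coordinatewise π-agree =
    π-agree re-linear , π-agree ci-linear , π-agree cj-linear , π-agree cij-linear

  module _ {k k⁻¹ : Carrier} (k*k⁻¹≈1 : k * k⁻¹ ≈ 1#) where

    kx+y≈z⇒x≈k⁻¹[z-y] : ∀ {x y z} → k * x + y ≈ z → x ≈ k⁻¹ * (z - y)
    kx+y≈z⇒x≈k⁻¹[z-y] {x} {y} {z} kx+y≈z = begin
      x                        ≈⟨ sym (*-identityˡ x) ⟩
      1# * x                   ≈⟨ *-congʳ (sym (trans (*-comm k⁻¹ k) k*k⁻¹≈1)) ⟩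
      k⁻¹ * k * x              ≈⟨ *-assoc k⁻¹ k x ⟩
      k⁻¹ * (k * x)            ≈⟨ *-congˡ (sym (//-rightDividesʳ y (k * x))) ⟩
      k⁻¹ * ((k * x + y) - y)  ≈⟨ *-congˡ (+-congʳ kx+y≈z) ⟩
      k⁻¹ * (z - y)            ∎

    module _ {π} (lin : IsLinearFunctional π) where
      open IsLinearFunctional lin

      private
        G : ℕ → Carrier
        G = π ∘ Q k

      sum-identity : ∀ n →
        π (Σ₁ n (Q k)) ≈ π (ι k⁻¹ ⊗ (Q k (suc n) ⊕ Q k n ⊖ Q k 1 ⊖ Q k 0))
      sum-identity n = begin
        π (Σ₁ n (Q k))                                     ≈⟨ Σ₁-homo (Q k) n ⟩
        sum₁ n G                                           ≈⟨ kx+y≈z⇒x≈k⁻¹[z-y] (*-sum₁ (Q-recurrent k) n) ⟩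
        k⁻¹ * ((G (suc n) + G n) - (G 1 + G 0))            ≈⟨ *-congˡ (+-congˡ (sym (⁻¹-∙-comm (G 1) (G 0)))) ⟩
        k⁻¹ * ((G (suc n) + G n) + (- G 1 - G 0))          ≈⟨ *-congˡ (sym (+-assoc _ _ _)) ⟩
        k⁻¹ * (((G (suc n) + G n) - G 1) - G 0)            ≈⟨ *-congˡ (+-congʳ (+-congʳ (sym (⊕-homo _ _)))) ⟩
        k⁻¹ * ((π (Q k (suc n) ⊕ Q k n) - G 1) - G 0)      ≈⟨ *-congˡ (+-congʳ (sym (⊖-homo _ _))) ⟩
        k⁻¹ * (π (Q k (suc n) ⊕ Q k n ⊖ Q k 1) - G 0)      ≈⟨ sym (ι⊗⊖-homo k⁻¹ _ _) ⟩
        π (ι k⁻¹ ⊗ (Q k (suc n) ⊕ Q k n ⊖ Q k 1 ⊖ Q k 0))  ∎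

      odd-sum-identity : ∀ n →
        π (Σ₁ n (Q k ∘ λ s → 2 N.* s N.∸ 1)) ≈ π (ι k⁻¹ ⊗ (Q k (2 N.* n) ⊖ Q k 0))
      odd-sum-identity n = begin
        π (Σ₁ n (Q k ∘ λ s → 2 N.* s N.∸ 1))  ≈⟨ Σ₁-homo _ n ⟩
        sum₁ n (G ∘ λ s → 2 N.* s N.∸ 1)      ≈⟨ kx+y≈z⇒x≈k⁻¹[z-y] (*-sum₁-odd (Q-recurrent k) n) ⟩
        k⁻¹ * (G (2 N.* n) - G 0)             ≈⟨ sym (ι⊗⊖-homo k⁻¹ _ _) ⟩
        π (ι k⁻¹ ⊗ (Q k (2 N.* n) ⊖ Q k 0))   ∎

      even-sum-identity : ∀ n →
        π (Σ₁ n (Q k ∘ (2 N.*_))) ≈ π (ι k⁻¹ ⊗ (Q k (2 N.* n N.+ 1) ⊖ Q k 1))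
      even-sum-identity n = begin
        π (Σ₁ n (Q k ∘ (2 N.*_)))                  ≈⟨ Σ₁-homo _ n ⟩
        sum₁ n (G ∘ (2 N.*_))                      ≈⟨ kx+y≈z⇒x≈k⁻¹[z-y] (*-sum₁-even (Q-recurrent k) n) ⟩
        k⁻¹ * (G (2 N.* n N.+ 1) - G 1)            ≈⟨ sym (ι⊗⊖-homo k⁻¹ _ _) ⟩
        π (ι k⁻¹ ⊗ (Q k (2 N.* n N.+ 1) ⊖ Q k 1))  ∎

mainTheorem6 : ∀ {c ℓ} (R : CommutativeRing c ℓ) → let open Bicomplex R in
    (k k⁻¹ : CommutativeRing.Carrier R) → CommutativeRing._≈_ R (CommutativeRing._*_ R k k⁻¹) (CommutativeRing.1# R) →
    (n : ℕ) → 1 ≤ n →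
      (Σ₁ n (λ s → Q k s) ≋ ι k⁻¹ ⊗ (Q k (suc n) ⊕ Q k n ⊖ Q k 1 ⊖ Q k 0))
      × (Σ₁ n (λ s → Q k (2 N.* s N.∸ 1)) ≋ ι k⁻¹ ⊗ (Q k (2 N.* n) ⊖ Q k 0))
      × (Σ₁ n (λ s → Q k (2 N.* s)) ≋ ι k⁻¹ ⊗ (Q k (2 N.* n N.+ 1) ⊖ Q k 1))
mainTheorem6 R k k⁻¹ k*k⁻¹≈1 n _ =
    ≋-coordinatewise (λ lin → sum-identity k*k⁻¹≈1 lin n)
  , ≋-coordinatewise (λ lin → odd-sum-identity k*k⁻¹≈1 lin n)
  , ≋-coordinatewise (λ lin → even-sum-identity k*k⁻¹≈1 lin n)
  where open BicomplexFibonacciSums R
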